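{- Let $k \ge 3$ be an integer, let $A = \{0,1\}^k \setminus \{0^k, 1^k\}$, and for $a, b \in \{0,1\}^k$ let $d(a,b)$ denote the Hamming distance (number of coordinates in which $a$ and $b$ differ). Consider the linear program $\mathcal{LP}_k$ in the variables $\lambda \in \mathbb{R}^+$ and $\pi : A \to [0,1]$ with constraints $$\sum_{a \in A} \pi(a) = 1, \qquad \pi(a) \ge 0 \ \ (\forall a \in A), \qquad \lambda = \sum_{a \in A} \pi(a) \left(\frac{1}{k-1}\right)^{d(a,a^*)} \ \ (\forall a^* \in A).$$ Then the solution to $\mathcal{LP}_k$ is $$\lambda = \frac{k^k + \left(\frac{ -k}{k-1}\right)^k}{(2k-2)^k - 2(k-2)^k + (-2)^k},$$ $$\pi(a) = \frac{(k-1)^k}{(2k-2)^k - 2(k-2)^k + (-2)^k}\left(1 - \left(\frac{ -1}{k-1}\right)^{d(a,0^k)}\right)\left(1 - \left(\frac{ -1}{k-1}\right)^{d(a,1^k)}\right) \quad \text{for all } a \in A;$$ that is, these values of $\lambda$ and $\pi$ satisfy all constraints of $\mathcal{LP}_k$ (with $\lambda > 0$ and $\pi(a) \in [0,1]$).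
   Context: $0^k$ and $1^k$ denote the all-zeros and all-ones vectors in $\{0,1\}^k$. $\mathcal{LP}_k$ has no objective; a solution means an assignment of values to $\lambda, \pi$ satisfying all constraints. -}

module Defs where

open import Data.Bool using (Bool; true; false; if_then_else_)
open import Data.Nat as ℕ using (ℕ; zero; suc)
open import Data.Integer using (+_)
open import Data.Rational using (ℚ; 0ℚ; 1ℚ; _+_; _*_; _-_; -_; _÷_; ≢-nonZero)
open import Data.Rational.Properties using (_≟_)
open import Data.Vec using (Vec; []; _∷_; replicate)
open import Data.List using (List; []; _∷_; _++_; map; foldr)
open import Relation.Nullary using (yes; no; ¬_)
open import Relation.Binary.PropositionalEquality using (_≡_)
open import Data.Product using (_×_)

infixr 8 _^ℚ_
_^ℚ_ : ℚ → ℕ → ℚ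
p ^ℚ zero  = 1ℚ
p ^ℚ suc n = p * (p ^ℚ n)

fromℕ : ℕ → ℚ
fromℕ n = Data.Rational._/_ (+ n) 1

-- total division (p /₀ 0 = 0); only used with nonzero denominators below
_/₀_ : ℚ → ℚ → ℚ
p /₀ q with q ≟ 0ℚ
... | yes _  = 0ℚ
... | no q≢0 = (p ÷ q) {{≢-nonZero q≢0}}

allVecs : (k : ℕ) → List (Vec Bool k)
allVecs zero    = [] ∷ []
allVecs (suc k) = map (false ∷_) (allVecs k) ++ map (true ∷_) (allVecs k)

ham : {k : ℕ} → Vec Bool k → Vec Bool k → ℕ
ham []       []       = 0
ham (x ∷ xs) (y ∷ ys) = (if xor x y then 1 else 0) ℕ.+ ham xs ys
  where
  xor : Bool → Bool → Bool
  xor true  b = if b then false else true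
  xor false b = b

zeros ones : (k : ℕ) → Vec Bool k
zeros k = replicate k false
ones  k = replicate k true

InA : {k : ℕ} → Vec Bool k → Set
InA {k} a = ¬ (a ≡ zeros k) × ¬ (a ≡ ones k)

isExtreme : {k : ℕ} → Vec Bool k → Bool
isExtreme []       = true
isExtreme (x ∷ xs) = allEq x xs
  where
  eqB : Bool → Bool → Bool
  eqB true  b = b
  eqB false b = if b then false else true
  allEq : {m : ℕ} → Bool → Vec Bool m → Bool
  allEq x []       = true
  allEq x (y ∷ ys) = if eqB x y then allEq x ys else false

sumA : (k : ℕ) → (Vec Bool k → ℚ) → ℚ
sumA k f = foldr (λ a s → (if isExtreme a then 0ℚ else f a) + s) 0ℚ (allVecs k)

denom : ℕ → ℚ
denom k = (fromℕ (2 ℕ.* k ℕ.∸ 2) ^ℚ k) - fromℕ 2 * (fromℕ (k ℕ.∸ 2) ^ℚ k)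
          + ((- fromℕ 2) ^ℚ k)

lamVal : ℕ → ℚ
lamVal k = ((fromℕ k ^ℚ k) + ((- fromℕ k) /₀ fromℕ (k ℕ.∸ 1)) ^ℚ k) /₀ denom k

piVal : (k : ℕ) → Vec Bool k → ℚ
piVal k a = ((fromℕ (k ℕ.∸ 1) ^ℚ k) /₀ denom k)
            * (1ℚ - (((- 1ℚ) /₀ fromℕ (k ℕ.∸ 1)) ^ℚ ham a (zeros k)))
            * (1ℚ - (((- 1ℚ) /₀ fromℕ (k ℕ.∸ 1)) ^ℚ ham a (ones k)))

weight : (k : ℕ) → Vec Bool k → Vec Bool k → ℚ
weight k a a* = (1ℚ /₀ fromℕ (k ℕ.∸ 1)) ^ℚ ham a a*

IsSolutionLP : (k : ℕ) → ℚ → (Vec Bool k → ℚ) → Set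
IsSolutionLP k lam π =
  (0ℚ Data.Rational.< lam)
  × (∀ (a : Vec Bool k) → InA a → (0ℚ Data.Rational.≤ π a) × (π a Data.Rational.≤ 1ℚ))
  × (sumA k π ≡ 1ℚ)
  × (∀ (a* : Vec Bool k) → InA a* → lam ≡ sumA k (λ a → π a * weight k a a*))

-- Write s = 1/(k-1) and r = -s.  Up to the normalising constant (k-1)^k/D, π(a) is
-- (1 - r^{d(a,0)}) (1 - r^{d(a,1)}), and both this and the LP weight s^{d(a,b)} are
-- products over the k coordinates of a.  Hence every sum over {0,1}^k occurring in
-- LP_k factorises into a product of k sums over a single bit.  For b ∈ A the two
-- middle terms of the expanded product vanish, because b has a coordinate where the
-- single-bit sum is s + r = 0; what is left is (1+s)^k (1 + r^k), which is the same
-- for all b.  Positivity of D comes for free: D is (k-1)^k times the sum of the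
-- nonnegative numbers (1 - r^{d(a,0)}) (1 - r^{d(a,1)}), one of which is positive.
module Submission where

open import Defs
open import Data.Bool using (Bool; true; false; not; _xor_; if_then_else_)
open import Data.Nat as ℕ using (ℕ; zero; suc; _≤_; s≤s)
import Data.Nat.Properties as ℕ
import Data.Nat.Coprimality as Coprimality
import Data.Integer as ℤ
import Data.Integer.Properties as ℤ
open import Data.Rational as ℚ using (ℚ; mkℚ; 0ℚ; 1ℚ; _+_; _*_; _-_; -_; 1/_)
import Data.Rational.Properties as ℚₚ
open import Data.Rational.Solver using (module +-*-Solver)
open import Data.Vec using (Vec; []; _∷_; replicate)
open import Data.Vec.Membership.Propositional using () renaming (_∈_ to _∈ᵥ_)
open import Data.Vec.Relation.Unary.Any using (here; there)
open import Data.List using (List; []; _∷_; _++_; map; foldr)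
open import Data.List.Membership.Propositional using (_∈_)
open import Data.List.Membership.Propositional.Properties using (∈-++⁺ˡ; ∈-++⁺ʳ; ∈-map⁺)
import Data.List.Relation.Unary.Any as ListAny
open import Data.Product using (_×_; _,_; proj₁; proj₂)
open import Data.Sum using (_⊎_; inj₁; inj₂)
open import Data.Empty using (⊥-elim)
open import Function using (_∘_)
open import Relation.Nullary using (yes; no)
open import Relation.Binary.PropositionalEquality

open +-*-Solver

-- Arithmetic in ℚ

*-pos : ∀ {p q} → 0ℚ ℚ.< p → 0ℚ ℚ.< q → 0ℚ ℚ.< p * q
*-pos {p} {q} 0<p 0<q =
  ℚₚ.positive⁻¹ (p * q) {{ℚₚ.pos*pos⇒pos p {{ℚ.positive 0<p}} q {{ℚ.positive 0<q}}}}

*-nonNeg : ∀ {p q} → 0ℚ ℚ.≤ p → 0ℚ ℚ.≤ q → 0ℚ ℚ.≤ p * q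
*-nonNeg {p} {q} 0≤p 0≤q =
  ℚₚ.nonNegative⁻¹ (p * q) {{ℚₚ.nonNeg*nonNeg⇒nonNeg p {{ℚ.nonNegative 0≤p}} q {{ℚ.nonNegative 0≤q}}}}

p<q⇒0<q-p : ∀ {p q} → p ℚ.< q → 0ℚ ℚ.< q - p
p<q⇒0<q-p {p} {q} h = subst (ℚ._< q - p) (ℚₚ.+-inverseʳ p) (ℚₚ.+-monoˡ-< (- p) h)

/₀≡*1/ : ∀ p q (q≢0 : q ≢ 0ℚ) → p /₀ q ≡ p * (1/ q) {{ℚ.≢-nonZero q≢0}}
/₀≡*1/ p q q≢0 with q ℚₚ.≟ 0ℚ
... | yes q≡0 = ⊥-elim (q≢0 q≡0)
... | no _    = refl

^ℚ-distrib-* : ∀ x y n → (x * y) ^ℚ n ≡ x ^ℚ n * y ^ℚ n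
^ℚ-distrib-* x y zero    = refl
^ℚ-distrib-* x y (suc n) rewrite ^ℚ-distrib-* x y n =
  solve 4 (λ x y X Y → (x :* y) :* (X :* Y) := (x :* X) :* (y :* Y)) refl x y (x ^ℚ n) (y ^ℚ n)

neg-^ℚ : ∀ x n → (- x) ^ℚ n ≡ x ^ℚ n ⊎ (- x) ^ℚ n ≡ - (x ^ℚ n)
neg-^ℚ x zero = inj₁ refl
neg-^ℚ x (suc n) with neg-^ℚ x n
... | inj₁ e = inj₂ (trans (cong ((- x) *_) e) (sym (ℚₚ.neg-distribˡ-* x (x ^ℚ n))))
... | inj₂ e = inj₁ (trans (cong ((- x) *_) e)
                       (solve 2 (λ a b → (:- a) :* (:- b) := a :* b) refl x (x ^ℚ n)))

^ℚ-pos : ∀ {x} n → 0ℚ ℚ.< x → 0ℚ ℚ.< x ^ℚ n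
^ℚ-pos zero    _   = ℚₚ.positive⁻¹ 1ℚ
^ℚ-pos (suc n) 0<x = *-pos 0<x (^ℚ-pos n 0<x)

^ℚ-nonNeg : ∀ {x} n → 0ℚ ℚ.≤ x → 0ℚ ℚ.≤ x ^ℚ n
^ℚ-nonNeg zero    _   = ℚₚ.nonNegative⁻¹ 1ℚ
^ℚ-nonNeg (suc n) 0≤x = *-nonNeg 0≤x (^ℚ-nonNeg n 0≤x)

^ℚ-suc-<1 : ∀ {x} n → 0ℚ ℚ.≤ x → x ℚ.< 1ℚ → x ^ℚ suc n ℚ.< 1ℚ
^ℚ-suc-<1 {x} zero    _   x<1 = subst (ℚ._< 1ℚ) (sym (ℚₚ.*-identityʳ x)) x<1
^ℚ-suc-<1 {x} (suc n) 0≤x x<1 = ℚₚ.≤-<-trans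
  (subst (x * x ^ℚ suc n ℚ.≤_) (ℚₚ.*-identityʳ x)
         (ℚₚ.*-monoˡ-≤-nonNeg x {{ℚ.nonNegative 0≤x}} (ℚₚ.<⇒≤ (^ℚ-suc-<1 n 0≤x x<1))))
  x<1

neg-^ℚ-suc-bounds : ∀ {s} n → 0ℚ ℚ.≤ s → s ℚ.< 1ℚ →
                    - 1ℚ ℚ.< (- s) ^ℚ suc n × (- s) ^ℚ suc n ℚ.< 1ℚ
neg-^ℚ-suc-bounds {s} n 0≤s s<1 with neg-^ℚ s (suc n)
... | inj₁ e rewrite e = ℚₚ.<-≤-trans (ℚₚ.negative⁻¹ (- 1ℚ)) (^ℚ-nonNeg (suc n) 0≤s)
                       , ^ℚ-suc-<1 n 0≤s s<1
... | inj₂ e rewrite e = ℚₚ.neg-antimono-< (^ℚ-suc-<1 n 0≤s s<1)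
                       , ℚₚ.≤-<-trans (ℚₚ.neg-antimono-≤ (^ℚ-nonNeg (suc n) 0≤s)) (ℚₚ.positive⁻¹ 1ℚ)

0<1-neg-^ℚ-suc : ∀ {s} n → 0ℚ ℚ.≤ s → s ℚ.< 1ℚ → 0ℚ ℚ.< 1ℚ - (- s) ^ℚ suc n
0<1-neg-^ℚ-suc n 0≤s s<1 = p<q⇒0<q-p (proj₂ (neg-^ℚ-suc-bounds n 0≤s s<1))

0<1+neg-^ℚ-suc : ∀ {s} n → 0ℚ ℚ.≤ s → s ℚ.< 1ℚ → 0ℚ ℚ.< 1ℚ + (- s) ^ℚ suc n
0<1+neg-^ℚ-suc {s} n 0≤s s<1 =
  subst (0ℚ ℚ.<_) (ℚₚ.+-comm ((- s) ^ℚ suc n) 1ℚ) (p<q⇒0<q-p (proj₁ (neg-^ℚ-suc-bounds n 0≤s s<1)))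

0≤1-neg-^ℚ : ∀ {s} n → 0ℚ ℚ.≤ s → s ℚ.< 1ℚ → 0ℚ ℚ.≤ 1ℚ - (- s) ^ℚ n
0≤1-neg-^ℚ zero    _   _   = ℚₚ.≤-reflexive (sym (ℚₚ.+-inverseʳ 1ℚ))
0≤1-neg-^ℚ (suc n) 0≤s s<1 = ℚₚ.<⇒≤ (0<1-neg-^ℚ-suc n 0≤s s<1)

fromℕ≡mkℚ : ∀ n → fromℕ n ≡ mkℚ (ℤ.+ n) 0 (Coprimality.sym (Coprimality.1-coprimeTo n))
fromℕ≡mkℚ n = ℚₚ.↥p/↧p≡p (mkℚ (ℤ.+ n) 0 (Coprimality.sym (Coprimality.1-coprimeTo n)))

fromℕ-suc : ∀ n → fromℕ (suc n) ≡ 1ℚ + fromℕ n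
fromℕ-suc n rewrite fromℕ≡mkℚ n =
  cong (λ z → z ℚ./ 1) (cong (λ t → ℤ.+ 1 ℤ.+ t) (sym (ℤ.*-identityʳ (ℤ.+ n))))

fromℕ-+ : ∀ a b → fromℕ (a ℕ.+ b) ≡ fromℕ a + fromℕ b
fromℕ-+ zero    b = sym (ℚₚ.+-identityˡ (fromℕ b))
fromℕ-+ (suc a) b rewrite fromℕ-suc (a ℕ.+ b) | fromℕ-+ a b | fromℕ-suc a =
  sym (ℚₚ.+-assoc 1ℚ (fromℕ a) (fromℕ b))

fromℕ-pos : ∀ n → 0ℚ ℚ.< fromℕ (suc n)
fromℕ-pos n rewrite fromℕ≡mkℚ (suc n) = ℚₚ.positive⁻¹ _

-- Finite sums

sumOver : {X : Set} → List X → (X → ℚ) → ℚ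
sumOver xs f = foldr (λ x acc → f x + acc) 0ℚ xs

module _ {X : Set} where

  sumOver-++ : ∀ (xs ys : List X) f → sumOver (xs ++ ys) f ≡ sumOver xs f + sumOver ys f
  sumOver-++ []       ys f = sym (ℚₚ.+-identityˡ _)
  sumOver-++ (x ∷ xs) ys f rewrite sumOver-++ xs ys f = sym (ℚₚ.+-assoc (f x) _ _)

  sumOver-map : ∀ {Y : Set} (g : Y → X) ys f → sumOver (map g ys) f ≡ sumOver ys (f ∘ g)
  sumOver-map g []       f = refl
  sumOver-map g (y ∷ ys) f = cong (f (g y) +_) (sumOver-map g ys f)

  sumOver-cong : ∀ xs {f g : X → ℚ} → (∀ x → f x ≡ g x) → sumOver xs f ≡ sumOver xs g
  sumOver-cong []       f≗g = refl
  sumOver-cong (x ∷ xs) f≗g = cong₂ _+_ (f≗g x) (sumOver-cong xs f≗g)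

  sumOver-*ˡ : ∀ xs c (f : X → ℚ) → sumOver xs (λ x → c * f x) ≡ c * sumOver xs f
  sumOver-*ˡ []       c f = sym (ℚₚ.*-zeroʳ c)
  sumOver-*ˡ (x ∷ xs) c f rewrite sumOver-*ˡ xs c f = sym (ℚₚ.*-distribˡ-+ c (f x) _)

  sumOver-+ : ∀ xs (f g : X → ℚ) → sumOver xs (λ x → f x + g x) ≡ sumOver xs f + sumOver xs g
  sumOver-+ []       f g = refl
  sumOver-+ (x ∷ xs) f g rewrite sumOver-+ xs f g =
    solve 4 (λ a b A B → (a :+ b) :+ (A :+ B) := (a :+ A) :+ (b :+ B)) refl
      (f x) (g x) (sumOver xs f) (sumOver xs g)

  sumOver-- : ∀ xs (f g : X → ℚ) → sumOver xs (λ x → f x - g x) ≡ sumOver xs f - sumOver xs g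
  sumOver-- []       f g = refl
  sumOver-- (x ∷ xs) f g rewrite sumOver-- xs f g =
    solve 4 (λ a b A B → (a :- b) :+ (A :- B) := (a :+ A) :- (b :+ B)) refl
      (f x) (g x) (sumOver xs f) (sumOver xs g)

  sumOver-nonNeg : ∀ xs {f : X → ℚ} → (∀ x → 0ℚ ℚ.≤ f x) → 0ℚ ℚ.≤ sumOver xs f
  sumOver-nonNeg []       f≥0 = ℚₚ.≤-refl
  sumOver-nonNeg (x ∷ xs) f≥0 = ℚₚ.+-mono-≤ (f≥0 x) (sumOver-nonNeg xs f≥0)

  ≤-sumOver : ∀ {xs} {f : X → ℚ} → (∀ x → 0ℚ ℚ.≤ f x) → ∀ {x} → x ∈ xs → f x ℚ.≤ sumOver xs f
  ≤-sumOver {y ∷ xs} {f} f≥0 (ListAny.here refl) =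
    subst (ℚ._≤ f y + sumOver xs f) (ℚₚ.+-identityʳ (f y)) (ℚₚ.+-monoʳ-≤ (f y) (sumOver-nonNeg xs f≥0))
  ≤-sumOver {y ∷ xs} {f} f≥0 (ListAny.there x∈xs) = ℚₚ.≤-trans (≤-sumOver f≥0 x∈xs)
    (subst (ℚ._≤ f y + sumOver xs f) (ℚₚ.+-identityˡ (sumOver xs f)) (ℚₚ.+-monoˡ-≤ (sumOver xs f) (f≥0 y)))

Σcube : (k : ℕ) → (Vec Bool k → ℚ) → ℚ
Σcube k = sumOver (allVecs k)

Σcube-suc : ∀ k f → Σcube (suc k) f ≡ Σcube k (λ a → f (false ∷ a)) + Σcube k (λ a → f (true ∷ a))
Σcube-suc k f = trans (sumOver-++ (map (false ∷_) (allVecs k)) _ f)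
  (cong₂ _+_ (sumOver-map (false ∷_) (allVecs k) f) (sumOver-map (true ∷_) (allVecs k) f))

∈-allVecs : ∀ {k} (a : Vec Bool k) → a ∈ allVecs k
∈-allVecs []                 = ListAny.here refl
∈-allVecs {suc k} (false ∷ a) = ∈-++⁺ˡ (∈-map⁺ (false ∷_) (∈-allVecs a))
∈-allVecs {suc k} (true ∷ a)  = ∈-++⁺ʳ (map (false ∷_) (allVecs k)) (∈-map⁺ (true ∷_) (∈-allVecs a))

isExtreme⇒zeros⊎ones : ∀ {k} (a : Vec Bool k) → isExtreme a ≡ true → a ≡ zeros k ⊎ a ≡ ones k
isExtreme⇒zeros⊎ones []           _ = inj₁ refl
isExtreme⇒zeros⊎ones (false ∷ []) _ = inj₁ refl
isExtreme⇒zeros⊎ones (true ∷ [])  _ = inj₂ refl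
isExtreme⇒zeros⊎ones (false ∷ true ∷ a) ()
isExtreme⇒zeros⊎ones (true ∷ false ∷ a) ()
isExtreme⇒zeros⊎ones (false ∷ false ∷ a) e with isExtreme⇒zeros⊎ones (false ∷ a) e
... | inj₁ a≡0 = inj₁ (cong (false ∷_) a≡0)
isExtreme⇒zeros⊎ones (true ∷ true ∷ a) e with isExtreme⇒zeros⊎ones (true ∷ a) e
... | inj₂ a≡1 = inj₂ (cong (true ∷_) a≡1)

sumA≡Σcube : ∀ k f → f (zeros k) ≡ 0ℚ → f (ones k) ≡ 0ℚ → sumA k f ≡ Σcube k f
sumA≡Σcube k f f0≡0 f1≡0 = sumOver-cong (allVecs k) dropExtreme
  where
  dropExtreme : ∀ a → (if isExtreme a then 0ℚ else f a) ≡ f a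
  dropExtreme a with isExtreme a in e
  ... | false = refl
  ... | true with isExtreme⇒zeros⊎ones a e
  ...   | inj₁ refl = sym f0≡0
  ...   | inj₂ refl = sym f1≡0

-- Coordinatewise products

coordProd : ∀ {k} → (Bool → Bool → ℚ) → Vec Bool k → Vec Bool k → ℚ
coordProd g []       []       = 1ℚ
coordProd g (x ∷ xs) (y ∷ ys) = g x y * coordProd g xs ys

marginal : ∀ {k} → (Bool → Bool → ℚ) → Vec Bool k → ℚ
marginal g []       = 1ℚ
marginal g (y ∷ ys) = (g false y + g true y) * marginal g ys

Σcube-coordProd : ∀ k g (b : Vec Bool k) → Σcube k (λ a → coordProd g a b) ≡ marginal g b
Σcube-coordProd zero    g []       = refl
Σcube-coordProd (suc k) g (y ∷ ys) = begin
  Σcube (suc k) (λ a → coordProd g a (y ∷ ys))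
    ≡⟨ Σcube-suc k (λ a → coordProd g a (y ∷ ys)) ⟩
  Σcube k (λ a → g false y * coordProd g a ys) + Σcube k (λ a → g true y * coordProd g a ys)
    ≡⟨ cong₂ _+_ (sumOver-*ˡ (allVecs k) (g false y) _) (sumOver-*ˡ (allVecs k) (g true y) _) ⟩
  g false y * Σcube k (λ a → coordProd g a ys) + g true y * Σcube k (λ a → coordProd g a ys)
    ≡⟨ cong (λ t → g false y * t + g true y * t) (Σcube-coordProd k g ys) ⟩
  g false y * marginal g ys + g true y * marginal g ys
    ≡⟨ sym (ℚₚ.*-distribʳ-+ (marginal g ys) (g false y) (g true y)) ⟩
  (g false y + g true y) * marginal g ys ∎
  where open ≡-Reasoning

coordProd-* : ∀ {k} g h (a b : Vec Bool k) →
              coordProd g a b * coordProd h a b ≡ coordProd (λ x y → g x y * h x y) a b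
coordProd-* g h []       []       = refl
coordProd-* g h (x ∷ xs) (y ∷ ys) =
  trans (solve 4 (λ a A b B → (a :* A) :* (b :* B) := (a :* b) :* (A :* B)) refl
           (g x y) (coordProd g xs ys) (h x y) (coordProd h xs ys))
        (cong (g x y * h x y *_) (coordProd-* g h xs ys))

coordProd-1 : ∀ {k} (a b : Vec Bool k) → coordProd (λ _ _ → 1ℚ) a b ≡ 1ℚ
coordProd-1 []       []       = refl
coordProd-1 (x ∷ xs) (y ∷ ys) rewrite coordProd-1 xs ys = refl

coordProd-replicate : ∀ g y {k} (a b : Vec Bool k) →
                      coordProd g a (replicate k y) ≡ coordProd (λ x _ → g x y) a b
coordProd-replicate g y []       []       = refl
coordProd-replicate g y (x ∷ xs) (_ ∷ ys) = cong (g x y *_) (coordProd-replicate g y xs ys)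

marginal-const : ∀ g c → (∀ y → g false y + g true y ≡ c) → ∀ {k} (b : Vec Bool k) →
                 marginal g b ≡ c ^ℚ k
marginal-const g c col≡c []       = refl
marginal-const g c col≡c (y ∷ ys) = cong₂ _*_ (col≡c y) (marginal-const g c col≡c ys)

marginal-zero : ∀ g y → g false y + g true y ≡ 0ℚ → ∀ {k} {b : Vec Bool k} → y ∈ᵥ b →
                marginal g b ≡ 0ℚ
marginal-zero g y col≡0 {b = _ ∷ ys} (here refl) =
  trans (cong (_* marginal g ys) col≡0) (ℚₚ.*-zeroˡ (marginal g ys))
marginal-zero g y col≡0 {b = y′ ∷ _} (there y∈ys) =
  trans (cong ((g false y′ + g true y′) *_) (marginal-zero g y col≡0 y∈ys)) (ℚₚ.*-zeroʳ (g false y′ + g true y′))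

≢replicate⇒not∈ : ∀ y {k} (b : Vec Bool k) → b ≢ replicate k y → not y ∈ᵥ b
≢replicate⇒not∈ y     []          b≢yᵏ = ⊥-elim (b≢yᵏ refl)
≢replicate⇒not∈ false (true ∷ b)  _    = here refl
≢replicate⇒not∈ true  (false ∷ b) _    = here refl
≢replicate⇒not∈ false (false ∷ b) b≢yᵏ = there (≢replicate⇒not∈ false b (b≢yᵏ ∘ cong (false ∷_)))
≢replicate⇒not∈ true  (true ∷ b)  b≢yᵏ = there (≢replicate⇒not∈ true b (b≢yᵏ ∘ cong (true ∷_)))

diffPow : ℚ → Bool → Bool → ℚ
diffPow r x y = if x xor y then r else 1ℚ

^ℚ-ham : ∀ r {k} (a b : Vec Bool k) → r ^ℚ ham a b ≡ coordProd (diffPow r) a b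
^ℚ-ham r []           []           = refl
^ℚ-ham r (false ∷ xs) (false ∷ ys) = trans (^ℚ-ham r xs ys) (sym (ℚₚ.*-identityˡ _))
^ℚ-ham r (false ∷ xs) (true ∷ ys)  = cong (r *_) (^ℚ-ham r xs ys)
^ℚ-ham r (true ∷ xs)  (false ∷ ys) = cong (r *_) (^ℚ-ham r xs ys)
^ℚ-ham r (true ∷ xs)  (true ∷ ys)  = trans (^ℚ-ham r xs ys) (sym (ℚₚ.*-identityˡ _))

^ℚ-ham-replicate : ∀ r y {k} (a b : Vec Bool k) →
                   r ^ℚ ham a (replicate k y) ≡ coordProd (λ x _ → diffPow r x y) a b
^ℚ-ham-replicate r y a b = trans (^ℚ-ham r a _) (coordProd-replicate (diffPow r) y a b)

ham-refl : ∀ {k} (a : Vec Bool k) → ham a a ≡ 0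
ham-refl []          = refl
ham-refl (false ∷ a) = ham-refl a
ham-refl (true ∷ a)  = ham-refl a

-- The unnormalised distribution

piShape : (k : ℕ) → ℚ → Vec Bool k → ℚ
piShape k r a = (1ℚ - r ^ℚ ham a (zeros k)) * (1ℚ - r ^ℚ ham a (ones k))

piShape-zeros : ∀ k r → piShape k r (zeros k) ≡ 0ℚ
piShape-zeros k r rewrite ham-refl (zeros k) = ℚₚ.*-zeroˡ (1ℚ - r ^ℚ ham (zeros k) (ones k))

piShape-ones : ∀ k r → piShape k r (ones k) ≡ 0ℚ
piShape-ones k r rewrite ham-refl (ones k) = ℚₚ.*-zeroʳ (1ℚ - r ^ℚ ham (ones k) (zeros k))

piShape-nonNeg : ∀ k {s} → 0ℚ ℚ.≤ s → s ℚ.< 1ℚ → ∀ a → 0ℚ ℚ.≤ piShape k (- s) a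
piShape-nonNeg k 0≤s s<1 a =
  *-nonNeg (0≤1-neg-^ℚ (ham a (zeros k)) 0≤s s<1) (0≤1-neg-^ℚ (ham a (ones k)) 0≤s s<1)

-- The term at a = (1,0,…,0) is positive: its distances to 0^k and 1^k are both nonzero.
Σcube-piShape-pos : ∀ n {s} → 0ℚ ℚ.≤ s → s ℚ.< 1ℚ →
                    0ℚ ℚ.< Σcube (suc (suc n)) (piShape (suc (suc n)) (- s))
Σcube-piShape-pos n 0≤s s<1 = ℚₚ.<-≤-trans
  (*-pos (0<1-neg-^ℚ-suc (ham (zeros (suc n)) (zeros (suc n))) 0≤s s<1)
         (0<1-neg-^ℚ-suc (ham (zeros n) (ones n)) 0≤s s<1))
  (≤-sumOver (piShape-nonNeg (suc (suc n)) 0≤s s<1) (∈-allVecs (true ∷ zeros (suc n))))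

Σcube-piShape-coordProd :
  ∀ k r g (b : Vec Bool k) →
  Σcube k (λ a → piShape k r a * coordProd g a b)
  ≡ marginal g b - marginal (λ x y → diffPow r x false * g x y) b
                 - marginal (λ x y → diffPow r x true * g x y) b
                 + marginal (λ x y → diffPow r x false * diffPow r x true * g x y) b
Σcube-piShape-coordProd k r g b = begin
  Σcube k (λ a → piShape k r a * W a)
    ≡⟨ sumOver-cong (allVecs k) expand ⟩
  Σcube k (λ a → W a - X a - Y a + XY a)
    ≡⟨ sumOver-+ (allVecs k) (λ a → W a - X a - Y a) XY ⟩
  Σcube k (λ a → W a - X a - Y a) + Σcube k XY
    ≡⟨ cong (_+ Σcube k XY) (trans (sumOver-- (allVecs k) (λ a → W a - X a) Y)
                                   (cong (_- Σcube k Y) (sumOver-- (allVecs k) W X))) ⟩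
  Σcube k W - Σcube k X - Σcube k Y + Σcube k XY
    ≡⟨ cong₂ _+_ (cong₂ _-_ (cong₂ _-_ (Σcube-coordProd k _ b) (Σcube-coordProd k _ b))
                            (Σcube-coordProd k _ b))
                 (Σcube-coordProd k _ b) ⟩
  _ ∎
  where
  open ≡-Reasoning
  Z O : Vec Bool k → ℚ
  Z a = coordProd (λ x _ → diffPow r x false) a b
  O a = coordProd (λ x _ → diffPow r x true) a b
  W X Y XY : Vec Bool k → ℚ
  W  a = coordProd g a b
  X  a = coordProd (λ x y → diffPow r x false * g x y) a b
  Y  a = coordProd (λ x y → diffPow r x true * g x y) a b
  XY a = coordProd (λ x y → diffPow r x false * diffPow r x true * g x y) a b
  expand : ∀ a → piShape k r a * W a ≡ W a - X a - Y a + XY a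
  expand a = begin
    piShape k r a * W a
      ≡⟨ cong₂ (λ u v → (1ℚ - u) * (1ℚ - v) * W a)
               (^ℚ-ham-replicate r false a b) (^ℚ-ham-replicate r true a b) ⟩
    (1ℚ - Z a) * (1ℚ - O a) * W a
      ≡⟨ solve 3 (λ u v w → (con 1ℚ :- u) :* (con 1ℚ :- v) :* w
                            := w :- u :* w :- v :* w :+ (u :* v) :* w) refl (Z a) (O a) (W a) ⟩
    W a - Z a * W a - O a * W a + (Z a * O a) * W a
      ≡⟨ cong₂ (λ u v → W a - u - v + (Z a * O a) * W a) (coordProd-* _ g a b) (coordProd-* _ g a b) ⟩
    W a - X a - Y a + (Z a * O a) * W a
      ≡⟨ cong (λ t → W a - X a - Y a + t * W a) (coordProd-* _ _ a b) ⟩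
    W a - X a - Y a + coordProd (λ x y → diffPow r x false * diffPow r x true) a b * W a
      ≡⟨ cong (W a - X a - Y a +_) (coordProd-* _ g a b) ⟩
    W a - X a - Y a + XY a ∎

Σcube-piShape : ∀ k r → Σcube k (piShape k r)
                ≡ (1ℚ + 1ℚ) ^ℚ k - (1ℚ + r) ^ℚ k - (1ℚ + r) ^ℚ k + ((1ℚ + 1ℚ) * r) ^ℚ k
Σcube-piShape k r = begin
  Σcube k (piShape k r)
    ≡⟨ sumOver-cong (allVecs k) (λ a → sym (trans (cong (piShape k r a *_) (coordProd-1 a b))
                                                  (ℚₚ.*-identityʳ (piShape k r a)))) ⟩
  Σcube k (λ a → piShape k r a * coordProd (λ _ _ → 1ℚ) a b)
    ≡⟨ Σcube-piShape-coordProd k r (λ _ _ → 1ℚ) b ⟩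
  _ ≡⟨ cong₂ _+_ (cong₂ _-_ (cong₂ _-_ (marginal-const _ _ (λ _ → refl) b)
                                      (marginal-const _ _ (λ _ → col-zeros) b))
                            (marginal-const _ _ (λ _ → col-ones) b))
                 (marginal-const _ _ (λ _ → col-both) b) ⟩
  (1ℚ + 1ℚ) ^ℚ k - (1ℚ + r) ^ℚ k - (1ℚ + r) ^ℚ k + ((1ℚ + 1ℚ) * r) ^ℚ k ∎
  where
  open ≡-Reasoning
  b = zeros k
  col-zeros : 1ℚ * 1ℚ + r * 1ℚ ≡ 1ℚ + r
  col-zeros = solve 1 (λ r → con 1ℚ :* con 1ℚ :+ r :* con 1ℚ := con 1ℚ :+ r) refl r
  col-ones : r * 1ℚ + 1ℚ * 1ℚ ≡ 1ℚ + r
  col-ones = solve 1 (λ r → r :* con 1ℚ :+ con 1ℚ :* con 1ℚ := con 1ℚ :+ r) refl r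
  col-both : 1ℚ * r * 1ℚ + r * 1ℚ * 1ℚ ≡ (1ℚ + 1ℚ) * r
  col-both = solve 1 (λ r → con 1ℚ :* r :* con 1ℚ :+ r :* con 1ℚ :* con 1ℚ
                            := (con 1ℚ :+ con 1ℚ) :* r) refl r

Σcube-piShape-weighted : ∀ k s (b : Vec Bool k) → b ≢ zeros k → b ≢ ones k →
                         Σcube k (λ a → piShape k (- s) a * s ^ℚ ham a b)
                         ≡ (1ℚ + s) ^ℚ k * (1ℚ + (- s) ^ℚ k)
Σcube-piShape-weighted k s b b≢0 b≢1 = begin
  Σcube k (λ a → piShape k (- s) a * s ^ℚ ham a b)
    ≡⟨ sumOver-cong (allVecs k) (λ a → cong (piShape k (- s) a *_) (^ℚ-ham s a b)) ⟩
  Σcube k (λ a → piShape k (- s) a * coordProd (diffPow s) a b)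
    ≡⟨ Σcube-piShape-coordProd k (- s) (diffPow s) b ⟩
  _ ≡⟨ cong₂ _+_ (cong₂ _-_ (cong₂ _-_ (marginal-const _ _ col b)
                                      (marginal-zero _ true col-zeros (≢replicate⇒not∈ false b b≢0)))
                            (marginal-zero _ false col-ones (≢replicate⇒not∈ true b b≢1)))
                 (marginal-const _ _ col-both b) ⟩
  (1ℚ + s) ^ℚ k - 0ℚ - 0ℚ + ((- s) * (1ℚ + s)) ^ℚ k
    ≡⟨ cong (λ t → (1ℚ + s) ^ℚ k - 0ℚ - 0ℚ + t) (^ℚ-distrib-* (- s) (1ℚ + s) k) ⟩
  (1ℚ + s) ^ℚ k - 0ℚ - 0ℚ + (- s) ^ℚ k * (1ℚ + s) ^ℚ k
    ≡⟨ solve 2 (λ u v → u :- con 0ℚ :- con 0ℚ :+ v :* u := u :* (con 1ℚ :+ v)) refl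
             ((1ℚ + s) ^ℚ k) ((- s) ^ℚ k) ⟩
  (1ℚ + s) ^ℚ k * (1ℚ + (- s) ^ℚ k) ∎
  where
  open ≡-Reasoning
  col : ∀ y → diffPow s false y + diffPow s true y ≡ 1ℚ + s
  col false = refl
  col true  = ℚₚ.+-comm s 1ℚ
  col-zeros : 1ℚ * s + (- s) * 1ℚ ≡ 0ℚ
  col-zeros = solve 1 (λ s → con 1ℚ :* s :+ (:- s) :* con 1ℚ := con 0ℚ) refl s
  col-ones : (- s) * 1ℚ + 1ℚ * s ≡ 0ℚ
  col-ones = solve 1 (λ s → (:- s) :* con 1ℚ :+ con 1ℚ :* s := con 0ℚ) refl s
  col-both : ∀ y → 1ℚ * (- s) * diffPow s false y + (- s) * 1ℚ * diffPow s true y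
                   ≡ (- s) * (1ℚ + s)
  col-both false = solve 1 (λ s → con 1ℚ :* (:- s) :* con 1ℚ :+ (:- s) :* con 1ℚ :* s
                                  := (:- s) :* (con 1ℚ :+ s)) refl s
  col-both true  = solve 1 (λ s → con 1ℚ :* (:- s) :* s :+ (:- s) :* con 1ℚ :* con 1ℚ
                                  := (:- s) :* (con 1ℚ :+ s)) refl s

-- The solution of LP_k for k = n + 3

module Solution (n : ℕ) where

  private
    k : ℕ
    k = suc (suc (suc n))

    m : ℚ
    m = fromℕ (suc (suc n))

    0<m : 0ℚ ℚ.< m
    0<m = fromℕ-pos (suc n)

    m≢0 : m ≢ 0ℚ
    m≢0 m≡0 = ℚₚ.<-irrefl (sym m≡0) 0<m

    instance
      m-nonZero : ℚ.NonZero m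
      m-nonZero = ℚ.≢-nonZero m≢0

    s : ℚ
    s = 1/ m

    m*s≡1 : m * s ≡ 1ℚ
    m*s≡1 = ℚₚ.*-inverseʳ m

    0≤s : 0ℚ ℚ.≤ s
    0≤s = ℚₚ.nonNegative⁻¹ s {{ℚₚ.pos⇒nonNeg s {{ℚₚ.1/pos⇒pos m {{ℚ.positive 0<m}}}}}}

    s<1 : s ℚ.< 1ℚ
    s<1 = subst₂ ℚ._<_ (ℚₚ.*-identityʳ s) (ℚₚ.*-inverseˡ m)
                 (ℚₚ.*-monoʳ-<-pos s {{ℚₚ.1/pos⇒pos m {{ℚ.positive 0<m}}}} 1<m)
      where
      1<m : 1ℚ ℚ.< m
      1<m = subst₂ ℚ._<_ (ℚₚ.+-identityʳ 1ℚ) (sym (fromℕ-suc (suc n)))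
                   (ℚₚ.+-monoʳ-< 1ℚ (fromℕ-pos n))

    m*[1+1]≡2k-2 : m * (1ℚ + 1ℚ) ≡ fromℕ (2 ℕ.* k ℕ.∸ 2)
    m*[1+1]≡2k-2 = begin
      m * (1ℚ + 1ℚ)                    ≡⟨ solve 1 (λ m → m :* (con 1ℚ :+ con 1ℚ) := m :+ m) refl m ⟩
      m + m                            ≡⟨ sym (fromℕ-+ (suc (suc n)) (suc (suc n))) ⟩
      fromℕ (suc (suc n) ℕ.+ suc (suc n)) ≡⟨ cong fromℕ (sym 2k-2≡[k-1]+[k-1]) ⟩
      fromℕ (2 ℕ.* k ℕ.∸ 2)            ∎
      where
      open ≡-Reasoning
      2k-2≡[k-1]+[k-1] : 2 ℕ.* k ℕ.∸ 2 ≡ suc (suc n) ℕ.+ suc (suc n)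
      2k-2≡[k-1]+[k-1] = cong suc (trans (ℕ.+-suc n _) (cong (λ t → suc (n ℕ.+ suc (suc t))) (ℕ.+-identityʳ n)))

    m*[1-s]≡k-2 : m * (1ℚ - s) ≡ fromℕ (k ℕ.∸ 2)
    m*[1-s]≡k-2 = begin
      m * (1ℚ - s)             ≡⟨ solve 2 (λ m s → m :* (con 1ℚ :- s) := m :- m :* s) refl m s ⟩
      m - m * s                ≡⟨ cong₂ _-_ (fromℕ-suc (suc n)) m*s≡1 ⟩
      1ℚ + fromℕ (suc n) - 1ℚ  ≡⟨ solve 1 (λ t → con 1ℚ :+ t :- con 1ℚ := t) refl (fromℕ (suc n)) ⟩
      fromℕ (suc n)            ∎
      where open ≡-Reasoning

    m*[2*-s]≡-2 : m * ((1ℚ + 1ℚ) * (- s)) ≡ - fromℕ 2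
    m*[2*-s]≡-2 = begin
      m * ((1ℚ + 1ℚ) * (- s))  ≡⟨ solve 2 (λ m s → m :* ((con 1ℚ :+ con 1ℚ) :* (:- s))
                                                  := :- ((con 1ℚ :+ con 1ℚ) :* (m :* s))) refl m s ⟩
      - ((1ℚ + 1ℚ) * (m * s))  ≡⟨ cong (λ t → - ((1ℚ + 1ℚ) * t)) m*s≡1 ⟩
      - fromℕ 2                ∎
      where open ≡-Reasoning

    m*[1+s]≡k : m * (1ℚ + s) ≡ fromℕ k
    m*[1+s]≡k = begin
      m * (1ℚ + s)  ≡⟨ solve 2 (λ m s → m :* (con 1ℚ :+ s) := m :* s :+ m) refl m s ⟩
      m * s + m     ≡⟨ cong (_+ m) m*s≡1 ⟩
      1ℚ + m        ≡⟨ sym (fromℕ-suc (suc (suc n))) ⟩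
      fromℕ k       ∎
      where open ≡-Reasoning

    S : ℚ
    S = Σcube k (piShape k (- s))

    denom≡m^k*S : denom k ≡ m ^ℚ k * S
    denom≡m^k*S = begin
      denom k
        ≡⟨ cong₂ (λ u v → u - fromℕ 2 * v + (- fromℕ 2) ^ℚ k)
                 (cong (_^ℚ k) (sym m*[1+1]≡2k-2)) (cong (_^ℚ k) (sym m*[1-s]≡k-2)) ⟩
      (m * (1ℚ + 1ℚ)) ^ℚ k - fromℕ 2 * (m * (1ℚ - s)) ^ℚ k + (- fromℕ 2) ^ℚ k
        ≡⟨ cong (λ t → (m * (1ℚ + 1ℚ)) ^ℚ k - fromℕ 2 * (m * (1ℚ - s)) ^ℚ k + t ^ℚ k)
                (sym m*[2*-s]≡-2) ⟩
      (m * (1ℚ + 1ℚ)) ^ℚ k - fromℕ 2 * (m * (1ℚ - s)) ^ℚ k + (m * ((1ℚ + 1ℚ) * (- s))) ^ℚ k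
        ≡⟨ cong₂ (λ u v → u - fromℕ 2 * v + (m * ((1ℚ + 1ℚ) * (- s))) ^ℚ k)
                 (^ℚ-distrib-* m (1ℚ + 1ℚ) k) (^ℚ-distrib-* m (1ℚ - s) k) ⟩
      m ^ℚ k * (1ℚ + 1ℚ) ^ℚ k - fromℕ 2 * (m ^ℚ k * (1ℚ - s) ^ℚ k) + (m * ((1ℚ + 1ℚ) * (- s))) ^ℚ k
        ≡⟨ cong (λ t → m ^ℚ k * (1ℚ + 1ℚ) ^ℚ k - fromℕ 2 * (m ^ℚ k * (1ℚ - s) ^ℚ k) + t)
                (^ℚ-distrib-* m ((1ℚ + 1ℚ) * (- s)) k) ⟩
      m ^ℚ k * (1ℚ + 1ℚ) ^ℚ k - fromℕ 2 * (m ^ℚ k * (1ℚ - s) ^ℚ k) + m ^ℚ k * ((1ℚ + 1ℚ) * (- s)) ^ℚ k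
        ≡⟨ solve 4 (λ M A B E → M :* A :- con (fromℕ 2) :* (M :* B) :+ M :* E
                                := M :* (A :- B :- B :+ E))
                   refl (m ^ℚ k) ((1ℚ + 1ℚ) ^ℚ k) ((1ℚ - s) ^ℚ k) (((1ℚ + 1ℚ) * (- s)) ^ℚ k) ⟩
      m ^ℚ k * ((1ℚ + 1ℚ) ^ℚ k - (1ℚ - s) ^ℚ k - (1ℚ - s) ^ℚ k + ((1ℚ + 1ℚ) * (- s)) ^ℚ k)
        ≡⟨ cong (m ^ℚ k *_) (sym (Σcube-piShape k (- s))) ⟩
      m ^ℚ k * S ∎
      where open ≡-Reasoning

    0<D : 0ℚ ℚ.< denom k
    0<D = subst (0ℚ ℚ.<_) (sym denom≡m^k*S) (*-pos (^ℚ-pos k 0<m) (Σcube-piShape-pos (suc n) 0≤s s<1))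

    D≢0 : denom k ≢ 0ℚ
    D≢0 D≡0 = ℚₚ.<-irrefl (sym D≡0) 0<D

    instance
      D-nonZero : ℚ.NonZero (denom k)
      D-nonZero = ℚ.≢-nonZero D≢0

    C : ℚ
    C = m ^ℚ k * 1/ denom k

    0<C : 0ℚ ℚ.< C
    0<C = *-pos (^ℚ-pos k 0<m) (ℚₚ.positive⁻¹ _ {{ℚₚ.1/pos⇒pos (denom k) {{ℚ.positive 0<D}}}})

    C*S≡1 : C * S ≡ 1ℚ
    C*S≡1 = begin
      C * S                      ≡⟨ solve 3 (λ M E S → M :* E :* S := M :* S :* E) refl (m ^ℚ k) (1/ denom k) S ⟩
      m ^ℚ k * S * 1/ denom k    ≡⟨ cong (_* 1/ denom k) (sym denom≡m^k*S) ⟩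
      denom k * 1/ denom k       ≡⟨ ℚₚ.*-inverseʳ (denom k) ⟩
      1ℚ                         ∎
      where open ≡-Reasoning

    piVal≡C*piShape : ∀ a → piVal k a ≡ C * piShape k (- s) a
    piVal≡C*piShape a =
      trans (cong₂ (λ c r → c * (1ℚ - r ^ℚ ham a (zeros k)) * (1ℚ - r ^ℚ ham a (ones k)))
                   (/₀≡*1/ (m ^ℚ k) (denom k) D≢0) -1/₀m≡-s)
            (ℚₚ.*-assoc C _ _)
      where
      -1/₀m≡-s : (- 1ℚ) /₀ m ≡ - s
      -1/₀m≡-s = trans (/₀≡*1/ (- 1ℚ) m m≢0)
                       (trans (sym (ℚₚ.neg-distribˡ-* 1ℚ s)) (cong -_ (ℚₚ.*-identityˡ s)))

    weight≡s^ham : ∀ a b → weight k a b ≡ s ^ℚ ham a b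
    weight≡s^ham a b = cong (_^ℚ ham a b) (trans (/₀≡*1/ 1ℚ m m≢0) (ℚₚ.*-identityˡ s))

    lamVal≡C*[1+s]^k[1+[-s]^k] : lamVal k ≡ C * ((1ℚ + s) ^ℚ k * (1ℚ + (- s) ^ℚ k))
    lamVal≡C*[1+s]^k[1+[-s]^k] = begin
      lamVal k
        ≡⟨ /₀≡*1/ _ (denom k) D≢0 ⟩
      (K ^ℚ k + ((- K) /₀ m) ^ℚ k) * 1/ denom k
        ≡⟨ cong (λ q → (K ^ℚ k + q ^ℚ k) * 1/ denom k)
                (trans (/₀≡*1/ (- K) m m≢0) (solve 2 (λ K s → (:- K) :* s := K :* (:- s)) refl K s)) ⟩
      (K ^ℚ k + (K * - s) ^ℚ k) * 1/ denom k
        ≡⟨ cong (λ t → (K ^ℚ k + t) * 1/ denom k) (^ℚ-distrib-* K (- s) k) ⟩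
      (K ^ℚ k + K ^ℚ k * (- s) ^ℚ k) * 1/ denom k
        ≡⟨ cong (λ t → (t + t * (- s) ^ℚ k) * 1/ denom k) K^k≡m^k*[1+s]^k ⟩
      (m ^ℚ k * (1ℚ + s) ^ℚ k + m ^ℚ k * (1ℚ + s) ^ℚ k * (- s) ^ℚ k) * 1/ denom k
        ≡⟨ solve 4 (λ M P N E → (M :* P :+ M :* P :* N) :* E := M :* E :* (P :* (con 1ℚ :+ N)))
                   refl (m ^ℚ k) ((1ℚ + s) ^ℚ k) ((- s) ^ℚ k) (1/ denom k) ⟩
      C * ((1ℚ + s) ^ℚ k * (1ℚ + (- s) ^ℚ k)) ∎
      where
      open ≡-Reasoning
      K : ℚ
      K = fromℕ k
      K^k≡m^k*[1+s]^k : K ^ℚ k ≡ m ^ℚ k * (1ℚ + s) ^ℚ k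
      K^k≡m^k*[1+s]^k = trans (cong (_^ℚ k) (sym m*[1+s]≡k)) (^ℚ-distrib-* m (1ℚ + s) k)

    piVal-zeros : piVal k (zeros k) ≡ 0ℚ
    piVal-zeros = trans (piVal≡C*piShape (zeros k))
                        (trans (cong (C *_) (piShape-zeros k (- s))) (ℚₚ.*-zeroʳ C))

    piVal-ones : piVal k (ones k) ≡ 0ℚ
    piVal-ones = trans (piVal≡C*piShape (ones k))
                       (trans (cong (C *_) (piShape-ones k (- s))) (ℚₚ.*-zeroʳ C))

    piVal-nonNeg : ∀ a → 0ℚ ℚ.≤ piVal k a
    piVal-nonNeg a = subst (0ℚ ℚ.≤_) (sym (piVal≡C*piShape a))
                           (*-nonNeg (ℚₚ.<⇒≤ 0<C) (piShape-nonNeg k 0≤s s<1 a))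

    Σcube-piVal : Σcube k (piVal k) ≡ 1ℚ
    Σcube-piVal = begin
      Σcube k (piVal k)                      ≡⟨ sumOver-cong (allVecs k) piVal≡C*piShape ⟩
      Σcube k (λ a → C * piShape k (- s) a)  ≡⟨ sumOver-*ˡ (allVecs k) C (piShape k (- s)) ⟩
      C * S                                  ≡⟨ C*S≡1 ⟩
      1ℚ                                     ∎
      where open ≡-Reasoning

  lamVal-pos : 0ℚ ℚ.< lamVal k
  lamVal-pos = subst (0ℚ ℚ.<_) (sym lamVal≡C*[1+s]^k[1+[-s]^k])
    (*-pos 0<C (*-pos (^ℚ-pos k (ℚₚ.+-mono-<-≤ (ℚₚ.positive⁻¹ 1ℚ) 0≤s))
                      (0<1+neg-^ℚ-suc (suc (suc n)) 0≤s s<1)))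

  piVal-∈[0,1] : ∀ a → 0ℚ ℚ.≤ piVal k a × piVal k a ℚ.≤ 1ℚ
  piVal-∈[0,1] a = piVal-nonNeg a
                 , subst (piVal k a ℚ.≤_) Σcube-piVal (≤-sumOver piVal-nonNeg (∈-allVecs a))

  sumA-piVal : sumA k (piVal k) ≡ 1ℚ
  sumA-piVal = trans (sumA≡Σcube k (piVal k) piVal-zeros piVal-ones) Σcube-piVal

  lamVal≡sumA-weighted : ∀ b → InA b → lamVal k ≡ sumA k (λ a → piVal k a * weight k a b)
  lamVal≡sumA-weighted b (b≢0 , b≢1) = sym (begin
    sumA k (λ a → piVal k a * weight k a b)
      ≡⟨ sumA≡Σcube k _ (vanishes (zeros k) piVal-zeros) (vanishes (ones k) piVal-ones) ⟩
    Σcube k (λ a → piVal k a * weight k a b)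
      ≡⟨ sumOver-cong (allVecs k) (λ a → trans (cong₂ _*_ (piVal≡C*piShape a) (weight≡s^ham a b))
                                               (ℚₚ.*-assoc C _ _)) ⟩
    Σcube k (λ a → C * (piShape k (- s) a * s ^ℚ ham a b))
      ≡⟨ sumOver-*ˡ (allVecs k) C _ ⟩
    C * Σcube k (λ a → piShape k (- s) a * s ^ℚ ham a b)
      ≡⟨ cong (C *_) (Σcube-piShape-weighted k s b b≢0 b≢1) ⟩
    C * ((1ℚ + s) ^ℚ k * (1ℚ + (- s) ^ℚ k))
      ≡⟨ sym lamVal≡C*[1+s]^k[1+[-s]^k] ⟩
    lamVal k ∎)
    where
    open ≡-Reasoning
    vanishes : ∀ a → piVal k a ≡ 0ℚ → piVal k a * weight k a b ≡ 0ℚ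
    vanishes a πa≡0 = trans (cong (_* weight k a b) πa≡0) (ℚₚ.*-zeroˡ (weight k a b))

lemma4p2 : (k : ℕ) → 3 ≤ k → IsSolutionLP k (lamVal k) (piVal k)
lemma4p2 (suc zero)       (s≤s ())
lemma4p2 (suc (suc zero)) (s≤s (s≤s ()))
lemma4p2 (suc (suc (suc n))) _ =
  lamVal-pos , (λ a _ → piVal-∈[0,1] a) , sumA-piVal , lamVal≡sumA-weighted
  where open Solution n
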